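{- Let $\Gamma$ be an environment and $P,Q$ typed solos terms. (1) If $P\equiv Q$ then $\Gamma\vdash P$ if and only if $\Gamma\vdash Q$. (2) If $P\to Q$ and $\Gamma\vdash P$ then $\Gamma\vdash Q$.
   Context: Triadic solos terms: $P ::= 0 \mid u(x_1x_2x_3) \mid \overline{u}\langle x_1x_2x_3\rangle \mid (P\mid P) \mid (\nu x)P$, where $(\nu x)P$ binds $x$. Structural congruence $\equiv$: least congruence containing $\alpha$-equivalence and $0\mid P\equiv P$, $P\mid Q\equiv Q\mid P$, $(P\mid Q)\mid R\equiv P\mid(Q\mid R)$, $(\nu x)(\nu y)P\equiv(\nu y)(\nu x)P$, $(\nu x)0\equiv 0$, $((\nu x)P)\mid Q\equiv(\nu x)(P\mid Q)$ if $x$ not free in $Q$. Reduction: $(\nu \vec z)(\overline u\langle x_1x_2x_3\rangle\mid u(y_1y_2y_3)\mid P)\to P\sigma$ where $\sigma$ is a most general unifier of $x_1x_2x_3$ and $y_1y_2y_3$ such that exactly the names $w$ of $\vec z$ satisfy $\sigma(w)\neq w$; closed under parallel composition, restriction and $\equiv$. Typed terms are solos terms whose restrictions carry a type $U\in\{V,W\}$, written $(\nu x^U)P$; $\equiv$ and $\to$ are lifted to typed terms with annotations carried along. An environment $\Gamma$ is a finite map from names to $\{V,W\}$, $\Gamma,x:U$ its extension by a fresh name. $\Gamma\vdash P$ is derived by: $\Gamma\vdash 0$; from $\Gamma\vdash P$ and $\Gamma\vdash Q$ infer $\Gamma\vdash P\mid Q$; from $\Gamma,x:U\vdash P$ infer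 $\Gamma\vdash(\nu x^U)P$; a solo (input or output) with subject $u$ and objects $a,b,c$ is typed by $\Gamma$ iff $\Gamma$ is defined on $u,a,b,c$ and $(\Gamma(u),\Gamma(a),\Gamma(b),\Gamma(c))\in\{(V,W,W,V),(W,W,V,V)\}$. -}

module Defs where

open import Data.Nat using (ℕ; _≟_)
open import Data.Bool using (if_then_else_)
open import Data.List using (List; []; _∷_; map; _++_)
open import Data.List.Membership.Propositional using (_∈_)
open import Data.Product using (_×_; _,_; proj₁; ∃)
open import Data.Maybe using (Maybe; just; nothing)
open import Relation.Nullary using (¬_; does)
open import Relation.Binary.PropositionalEquality using (_≡_; _≢_)

Name : Set
Name = ℕ

data Ty : Set where
  V W : Ty

infixr 5 _∣_

data Term : Set where
  𝟎   : Term
  inp : (u x₁ x₂ x₃ : Name) → Term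
  out : (u x₁ x₂ x₃ : Name) → Term
  _∣_ : Term → Term → Term
  ν   : (x : Name) → (U : Ty) → Term → Term

νs : List (Name × Ty) → Term → Term
νs []             P = P
νs ((z , U) ∷ zs) P = ν z U (νs zs P)

data _∈fn_ (a : Name) : Term → Set where
  fn-inp  : ∀ {u x₁ x₂ x₃} → a ∈ (u ∷ x₁ ∷ x₂ ∷ x₃ ∷ []) → a ∈fn inp u x₁ x₂ x₃
  fn-out  : ∀ {u x₁ x₂ x₃} → a ∈ (u ∷ x₁ ∷ x₂ ∷ x₃ ∷ []) → a ∈fn out u x₁ x₂ x₃
  fn-parˡ : ∀ {P Q} → a ∈fn P → a ∈fn (P ∣ Q)
  fn-parʳ : ∀ {P Q} → a ∈fn Q → a ∈fn (P ∣ Q)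
  fn-ν    : ∀ {x U P} → a ∈fn P → a ≢ x → a ∈fn ν x U P

bn : Term → List Name
bn 𝟎         = []
bn (inp _ _ _ _) = []
bn (out _ _ _ _) = []
bn (P ∣ Q)   = bn P ++ bn Q
bn (ν x _ P) = x ∷ bn P

swapN : Name → Name → Name → Name
swapN a b n = if does (n ≟ a) then b else (if does (n ≟ b) then a else n)

swapT : Name → Name → Term → Term
swapT a b 𝟎               = 𝟎
swapT a b (inp u x y z)   = inp (swapN a b u) (swapN a b x) (swapN a b y) (swapN a b z)
swapT a b (out u x y z)   = out (swapN a b u) (swapN a b x) (swapN a b y) (swapN a b z)
swapT a b (P ∣ Q)         = swapT a b P ∣ swapT a b Q
swapT a b (ν x U P)       = ν (swapN a b x) U (swapT a b P)

-- naive application of a name substitution to every name of a term;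
-- used only under the capture-avoidance side condition below
substT : (Name → Name) → Term → Term
substT σ 𝟎             = 𝟎
substT σ (inp u x y z) = inp (σ u) (σ x) (σ y) (σ z)
substT σ (out u x y z) = out (σ u) (σ x) (σ y) (σ z)
substT σ (P ∣ Q)       = substT σ P ∣ substT σ Q
substT σ (ν x U P)     = ν (σ x) U (substT σ P)

-- α-equivalence (Gabbay–Pitts style, annotations carried along)

infix 4 _=α_
data _=α_ : Term → Term → Set where
  α-𝟎    : 𝟎 =α 𝟎
  α-inp  : ∀ {u x y z} → inp u x y z =α inp u x y z
  α-out  : ∀ {u x y z} → out u x y z =α out u x y z
  α-par  : ∀ {P P′ Q Q′} → P =α P′ → Q =α Q′ → (P ∣ Q) =α (P′ ∣ Q′)
  α-ν    : ∀ {x U P Q} → P =α Q → ν x U P =α ν x U Q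
  α-νdif : ∀ {x y U P Q} → x ≢ y → ¬ (x ∈fn Q) → P =α swapT x y Q →
           ν x U P =α ν y U Q

infix 4 _≡s_
data _≡s_ : Term → Term → Set where
  ≡-α      : ∀ {P Q} → P =α Q → P ≡s Q
  ≡-refl   : ∀ {P} → P ≡s P
  ≡-sym    : ∀ {P Q} → P ≡s Q → Q ≡s P
  ≡-trans  : ∀ {P Q R} → P ≡s Q → Q ≡s R → P ≡s R
  ≡-parˡ   : ∀ {P P′ Q} → P ≡s P′ → (P ∣ Q) ≡s (P′ ∣ Q)
  ≡-parʳ   : ∀ {P Q Q′} → Q ≡s Q′ → (P ∣ Q) ≡s (P ∣ Q′)
  ≡-ν      : ∀ {x U P P′} → P ≡s P′ → ν x U P ≡s ν x U P′
  ≡-unit   : ∀ {P} → (𝟎 ∣ P) ≡s P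
  ≡-comm   : ∀ {P Q} → (P ∣ Q) ≡s (Q ∣ P)
  ≡-assoc  : ∀ {P Q R} → ((P ∣ Q) ∣ R) ≡s (P ∣ (Q ∣ R))
  ≡-νswap  : ∀ {x y U U′ P} → x ≢ y → ν x U (ν y U′ P) ≡s ν y U′ (ν x U P)
  ≡-ν𝟎     : ∀ {x U} → ν x U 𝟎 ≡s 𝟎
  ≡-extr   : ∀ {x U P Q} → ¬ (x ∈fn Q) → (ν x U P ∣ Q) ≡s ν x U (P ∣ Q)

Unifier : (Name → Name) → (x₁ x₂ x₃ y₁ y₂ y₃ : Name) → Set
Unifier σ x₁ x₂ x₃ y₁ y₂ y₃ = σ x₁ ≡ σ y₁ × σ x₂ ≡ σ y₂ × σ x₃ ≡ σ y₃

MGU : (Name → Name) → (x₁ x₂ x₃ y₁ y₂ y₃ : Name) → Set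
MGU σ x₁ x₂ x₃ y₁ y₂ y₃ =
  Unifier σ x₁ x₂ x₃ y₁ y₂ y₃ ×
  (∀ ρ → Unifier ρ x₁ x₂ x₃ y₁ y₂ y₃ → ∃ λ (θ : Name → Name) → ∀ n → ρ n ≡ θ (σ n)) ×
  (∀ n → σ (σ n) ≡ σ n)

MovesExactly : (Name → Name) → List Name → Set
MovesExactly σ zs = ∀ w → ((σ w ≢ w → w ∈ zs) × (w ∈ zs → σ w ≢ w))

CaptureAvoiding : (Name → Name) → Term → Set
CaptureAvoiding σ P = ∀ b → b ∈ bn P → ∀ w → σ w ≢ w → (b ≢ w × b ≢ σ w)

infix 4 _⟶_
data _⟶_ : Term → Term → Set where
  red-comm : ∀ {zs u x₁ x₂ x₃ y₁ y₂ y₃ P σ} →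
             MGU σ x₁ x₂ x₃ y₁ y₂ y₃ →
             MovesExactly σ (map proj₁ zs) →
             CaptureAvoiding σ P →
             νs zs (out u x₁ x₂ x₃ ∣ (inp u y₁ y₂ y₃ ∣ P)) ⟶ substT σ P
  red-par  : ∀ {P P′ Q} → P ⟶ P′ → (P ∣ Q) ⟶ (P′ ∣ Q)
  red-ν    : ∀ {x U P P′} → P ⟶ P′ → ν x U P ⟶ ν x U P′
  red-≡    : ∀ {P P′ Q′ Q} → P ≡s P′ → P′ ⟶ Q′ → Q′ ≡s Q → P ⟶ Q

-- finite map; Γ , x : U is  (x , U) ∷ Γ  (the newest binding of x wins)
Env : Set
Env = List (Name × Ty)

lookup : Env → Name → Maybe Ty
lookup []             n = nothing
lookup ((x , U) ∷ Γ) n = if does (x ≟ n) then just U else lookup Γ n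

data Allowed : Ty → Ty → Ty → Ty → Set where
  vwwv : Allowed V W W V
  wwvv : Allowed W W V V

infix 3 _⊢_
data _⊢_ (Γ : Env) : Term → Set where
  ⊢𝟎   : Γ ⊢ 𝟎
  ⊢par : ∀ {P Q} → Γ ⊢ P → Γ ⊢ Q → Γ ⊢ (P ∣ Q)
  ⊢ν   : ∀ {x U P} → ((x , U) ∷ Γ) ⊢ P → Γ ⊢ ν x U P
  ⊢inp : ∀ {u a b c T₀ T₁ T₂ T₃} →
         lookup Γ u ≡ just T₀ → lookup Γ a ≡ just T₁ →
         lookup Γ b ≡ just T₂ → lookup Γ c ≡ just T₃ →
         Allowed T₀ T₁ T₂ T₃ → Γ ⊢ inp u a b c
  ⊢out : ∀ {u a b c T₀ T₁ T₂ T₃} →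
         lookup Γ u ≡ just T₀ → lookup Γ a ≡ just T₁ →
         lookup Γ b ≡ just T₂ → lookup Γ c ≡ just T₃ →
         Allowed T₀ T₁ T₂ T₃ → Γ ⊢ out u a b c

module Submission where

-- Typing a term only consults the types its free names receive: a solo is
-- typed by looking up its subject and objects.  The central lemma ⊢-rename
-- makes this precise for name substitutions: if σ never identifies a bound
-- name of P with another name, and Δ gives σ n the type Γ gives n for every
-- free name n of P, then  Γ ⊢ P ⇔ Δ ⊢ P[σ].  Taking σ = id yields
-- insensitivity to irrelevant bindings (weakening by fresh names, exchange
-- of binders); taking σ a transposition yields invariance under
-- α-conversion.
--
-- For part (2) only the communication axiom needs thought.  Typing both
-- partners forces corresponding objects to have equal types (the type of
-- the subject determines those of the objects), so the type assignment,
-- viewed as a function on names, unifies the two object triples.  A most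
-- general idempotent unifier σ is absorbed by every unifier, hence σ
-- preserves types, and ⊢-rename carries the continuation across σ.

open import Defs
open import Data.Nat using (_≟_)
open import Data.Product using (_×_; _,_; proj₁; proj₂)
open import Data.List using (List; []; _∷_; map)
open import Data.List.Membership.Propositional using (_∈_; _∉_)
open import Data.List.Membership.Propositional.Properties using (∈-++⁺ˡ; ∈-++⁺ʳ)
open import Data.List.Relation.Unary.Any using (here; there)
open import Data.Maybe using (Maybe; just; nothing)
open import Function using (id)
open import Function.Bundles using (_⇔_; mk⇔; Equivalence)
open import Function.Properties.Equivalence using ()
  renaming (refl to ⇔-refl; sym to ⇔-sym; trans to ⇔-trans)
open import Relation.Nullary using (¬_; yes; no; contradiction)
open import Relation.Nullary.Decidable using (dec-true; dec-false)
open import Relation.Binary.PropositionalEquality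
open ≡-Reasoning
open Equivalence using (to; from)

infixr 5 _⟨⇔⟩_
_⟨⇔⟩_ : ∀ {A B C : Set} → A ⇔ B → B ⇔ C → A ⇔ C
_⟨⇔⟩_ = ⇔-trans

lookup-here : ∀ Γ x U → lookup ((x , U) ∷ Γ) x ≡ just U
lookup-here Γ x U rewrite dec-true (x ≟ x) refl = refl

lookup-there : ∀ Γ {x} U {n} → x ≢ n → lookup ((x , U) ∷ Γ) n ≡ lookup Γ n
lookup-there Γ {x} U {n} x≢n rewrite dec-false (x ≟ n) x≢n = refl

lookup-exchange : ∀ {Γ x y U U′} → x ≢ y → ∀ n →
  lookup ((x , U) ∷ (y , U′) ∷ Γ) n ≡ lookup ((y , U′) ∷ (x , U) ∷ Γ) n
lookup-exchange {x = x} {y} x≢y n with x ≟ n | y ≟ n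
... | yes refl | yes refl = contradiction refl x≢y
... | yes x≡n  | no y≢n  rewrite dec-true  (x ≟ n) x≡n | dec-false (y ≟ n) y≢n = refl
... | no x≢n   | yes y≡n rewrite dec-false (x ≟ n) x≢n | dec-true  (y ≟ n) y≡n = refl
... | no x≢n   | no y≢n  rewrite dec-false (x ≟ n) x≢n | dec-false (y ≟ n) y≢n = refl

fresh-≢ : ∀ {x n P} → ¬ (x ∈fn P) → n ∈fn P → x ≢ n
fresh-≢ x∉P n∈P refl = x∉P n∈P

data SoloType : Maybe Ty → Maybe Ty → Maybe Ty → Maybe Ty → Set where
  allowed : ∀ {T₀ T₁ T₂ T₃} → Allowed T₀ T₁ T₂ T₃ →
            SoloType (just T₀) (just T₁) (just T₂) (just T₃)

SoloTyped : Env → (u a b c : Name) → Set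
SoloTyped Γ u a b c = SoloType (lookup Γ u) (lookup Γ a) (lookup Γ b) (lookup Γ c)

solo-intro : ∀ {t₀ t₁ t₂ t₃ T₀ T₁ T₂ T₃} →
  t₀ ≡ just T₀ → t₁ ≡ just T₁ → t₂ ≡ just T₂ → t₃ ≡ just T₃ →
  Allowed T₀ T₁ T₂ T₃ → SoloType t₀ t₁ t₂ t₃
solo-intro refl refl refl refl t = allowed t

solo-elim : ∀ {t₀ t₁ t₂ t₃} {R : Set} → SoloType t₀ t₁ t₂ t₃ →
  (∀ {T₀ T₁ T₂ T₃} → t₀ ≡ just T₀ → t₁ ≡ just T₁ → t₂ ≡ just T₂ → t₃ ≡ just T₃ →
     Allowed T₀ T₁ T₂ T₃ → R) → R
solo-elim (allowed t) k = k refl refl refl refl t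

⊢inp⇔ : ∀ {Γ u a b c} → (Γ ⊢ inp u a b c) ⇔ SoloTyped Γ u a b c
⊢inp⇔ = mk⇔ (λ { (⊢inp e₀ e₁ e₂ e₃ t) → solo-intro e₀ e₁ e₂ e₃ t }) (λ s → solo-elim s ⊢inp)

⊢out⇔ : ∀ {Γ u a b c} → (Γ ⊢ out u a b c) ⇔ SoloTyped Γ u a b c
⊢out⇔ = mk⇔ (λ { (⊢out e₀ e₁ e₂ e₃ t) → solo-intro e₀ e₁ e₂ e₃ t }) (λ s → solo-elim s ⊢out)

solo-cong : ∀ {t₀ t₁ t₂ t₃ s₀ s₁ s₂ s₃} →
  t₀ ≡ s₀ → t₁ ≡ s₁ → t₂ ≡ s₂ → t₃ ≡ s₃ → SoloType t₀ t₁ t₂ t₃ ⇔ SoloType s₀ s₁ s₂ s₃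
solo-cong refl refl refl refl = ⇔-refl

objects-determined : ∀ {t₀ t₁ t₂ t₃ s₁ s₂ s₃} →
  SoloType t₀ t₁ t₂ t₃ → SoloType t₀ s₁ s₂ s₃ → t₁ ≡ s₁ × t₂ ≡ s₂ × t₃ ≡ s₃
objects-determined (allowed vwwv) (allowed vwwv) = refl , refl , refl
objects-determined (allowed wwvv) (allowed wwvv) = refl , refl , refl

BinderInjective : (Name → Name) → Term → Set
BinderInjective σ P = ∀ b → b ∈ bn P → ∀ n → n ≢ b → σ n ≢ σ b

injective⇒binderInjective : ∀ {σ} → (∀ m n → σ m ≡ σ n → m ≡ n) → ∀ P → BinderInjective σ P
injective⇒binderInjective σ-inj P b _ n n≢b σn≡σb = n≢b (σ-inj n b σn≡σb)

TypeRenaming : (Name → Name) → Env → Env → Term → Set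
TypeRenaming σ Γ Δ P = ∀ n → n ∈fn P → lookup Δ (σ n) ≡ lookup Γ n

TypeRenaming-ν : ∀ {σ x U P Γ Δ} → BinderInjective σ (ν x U P) →
  TypeRenaming σ Γ Δ (ν x U P) → TypeRenaming σ ((x , U) ∷ Γ) ((σ x , U) ∷ Δ) P
TypeRenaming-ν {σ} {x} {U} {P} {Γ} {Δ} inj ren n n∈P with n ≟ x
... | yes refl = trans (lookup-here Δ (σ n) U) (sym (lookup-here Γ n U))
... | no n≢x = begin
  lookup ((σ x , U) ∷ Δ) (σ n) ≡⟨ lookup-there Δ U (≢-sym (inj x (here refl) n n≢x)) ⟩
  lookup Δ (σ n)               ≡⟨ ren n (fn-ν n∈P n≢x) ⟩
  lookup Γ n                   ≡⟨ sym (lookup-there Γ U (≢-sym n≢x)) ⟩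
  lookup ((x , U) ∷ Γ) n       ∎

solo-rename : ∀ {σ : Name → Name} {Γ Δ : Env} {u a b c : Name} →
  (∀ n → n ∈ (u ∷ a ∷ b ∷ c ∷ []) → lookup Δ (σ n) ≡ lookup Γ n) →
  SoloTyped Γ u a b c ⇔ SoloTyped Δ (σ u) (σ a) (σ b) (σ c)
solo-rename ren = solo-cong (sym (ren _ (here refl))) (sym (ren _ (there (here refl))))
  (sym (ren _ (there (there (here refl))))) (sym (ren _ (there (there (there (here refl))))))

⊢par-cong : ∀ {Γ Δ P P′ Q Q′} → (Γ ⊢ P) ⇔ (Δ ⊢ P′) → (Γ ⊢ Q) ⇔ (Δ ⊢ Q′) →
  (Γ ⊢ P ∣ Q) ⇔ (Δ ⊢ P′ ∣ Q′)
⊢par-cong p q = mk⇔ (λ { (⊢par d e) → ⊢par (to p d) (to q e) })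
                    (λ { (⊢par d e) → ⊢par (from p d) (from q e) })

⊢ν-cong : ∀ {Γ Δ x y U U′ P Q} → (((x , U) ∷ Γ) ⊢ P) ⇔ (((y , U′) ∷ Δ) ⊢ Q) →
  (Γ ⊢ ν x U P) ⇔ (Δ ⊢ ν y U′ Q)
⊢ν-cong p = mk⇔ (λ { (⊢ν d) → ⊢ν (to p d) }) (λ { (⊢ν d) → ⊢ν (from p d) })

⊢-rename : ∀ σ P {Γ Δ} → BinderInjective σ P → TypeRenaming σ Γ Δ P →
  (Γ ⊢ P) ⇔ (Δ ⊢ substT σ P)
⊢-rename σ 𝟎 _ _ = mk⇔ (λ _ → ⊢𝟎) (λ _ → ⊢𝟎)
⊢-rename σ (inp u a b c) {Γ} {Δ} _ ren =
  ⊢inp⇔ ⟨⇔⟩ solo-rename {σ} {Γ} {Δ} (λ n m → ren n (fn-inp m)) ⟨⇔⟩ ⇔-sym ⊢inp⇔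
⊢-rename σ (out u a b c) {Γ} {Δ} _ ren =
  ⊢out⇔ ⟨⇔⟩ solo-rename {σ} {Γ} {Δ} (λ n m → ren n (fn-out m)) ⟨⇔⟩ ⇔-sym ⊢out⇔
⊢-rename σ (P ∣ Q) inj ren = ⊢par-cong
  (⊢-rename σ P (λ b m → inj b (∈-++⁺ˡ m)) (λ n m → ren n (fn-parˡ m)))
  (⊢-rename σ Q (λ b m → inj b (∈-++⁺ʳ (bn P) m)) (λ n m → ren n (fn-parʳ m)))
⊢-rename σ (ν x U P) {Γ} {Δ} inj ren =
  ⊢ν-cong (⊢-rename σ P (λ b m → inj b (there m)) (TypeRenaming-ν {Γ = Γ} {Δ} inj ren))

substT-id : ∀ P → substT id P ≡ P
substT-id 𝟎             = refl
substT-id (inp u a b c) = refl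
substT-id (out u a b c) = refl
substT-id (P ∣ Q)       = cong₂ _∣_ (substT-id P) (substT-id Q)
substT-id (ν x U P)     = cong (ν x U) (substT-id P)

⊢-env-agree : ∀ {Γ Δ} P → (∀ n → n ∈fn P → lookup Δ n ≡ lookup Γ n) → (Γ ⊢ P) ⇔ (Δ ⊢ P)
⊢-env-agree {Γ} {Δ} P agree = subst (λ R → (Γ ⊢ P) ⇔ (Δ ⊢ R)) (substT-id P)
  (⊢-rename id P (injective⇒binderInjective (λ _ _ e → e) P) agree)

⊢-fresh : ∀ {Γ x U} Q → ¬ (x ∈fn Q) → (Γ ⊢ Q) ⇔ (((x , U) ∷ Γ) ⊢ Q)
⊢-fresh {Γ} {U = U} Q x∉Q =
  ⊢-env-agree Q (λ n n∈Q → lookup-there Γ U (fresh-≢ x∉Q n∈Q))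

swap-left : ∀ a b → swapN a b a ≡ b
swap-left a b rewrite dec-true (a ≟ a) refl = refl

swap-right : ∀ a b → swapN a b b ≡ a
swap-right a b with b ≟ a
... | yes refl rewrite dec-true (b ≟ b) refl = refl
... | no b≢a   rewrite dec-false (b ≟ a) b≢a | dec-true (b ≟ b) refl = refl

swap-other : ∀ a b n → n ≢ a → n ≢ b → swapN a b n ≡ n
swap-other a b n n≢a n≢b rewrite dec-false (n ≟ a) n≢a | dec-false (n ≟ b) n≢b = refl

swap-involutive : ∀ a b n → swapN a b (swapN a b n) ≡ n
swap-involutive a b n with n ≟ a | n ≟ b
... | yes refl | _ = trans (cong (swapN n b) (swap-left n b)) (swap-right n b)
... | no _ | yes refl = trans (cong (swapN a n) (swap-right a n)) (swap-left a n)
... | no n≢a | no n≢b =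
  trans (cong (swapN a b) (swap-other a b n n≢a n≢b)) (swap-other a b n n≢a n≢b)

swap-injective : ∀ a b m n → swapN a b m ≡ swapN a b n → m ≡ n
swap-injective a b m n e = begin
  m                         ≡⟨ sym (swap-involutive a b m) ⟩
  swapN a b (swapN a b m)   ≡⟨ cong (swapN a b) e ⟩
  swapN a b (swapN a b n)   ≡⟨ swap-involutive a b n ⟩
  n                         ∎

swapT≡substT : ∀ a b P → swapT a b P ≡ substT (swapN a b) P
swapT≡substT a b 𝟎             = refl
swapT≡substT a b (inp u x y z) = refl
swapT≡substT a b (out u x y z) = refl
swapT≡substT a b (P ∣ Q)       = cong₂ _∣_ (swapT≡substT a b P) (swapT≡substT a b Q)
swapT≡substT a b (ν x U P)     = cong (ν (swapN a b x) U) (swapT≡substT a b P)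

swap-TypeRenaming : ∀ {Γ x y U Q} → ¬ (x ∈fn Q) →
  TypeRenaming (swapN x y) ((y , U) ∷ Γ) ((x , U) ∷ Γ) Q
swap-TypeRenaming {Γ} {x} {y} {U} x∉Q n n∈Q with n ≟ y
... | yes refl = begin
  lookup ((x , U) ∷ Γ) (swapN x n n) ≡⟨ cong (lookup ((x , U) ∷ Γ)) (swap-right x n) ⟩
  lookup ((x , U) ∷ Γ) x             ≡⟨ lookup-here Γ x U ⟩
  just U                             ≡⟨ sym (lookup-here Γ n U) ⟩
  lookup ((n , U) ∷ Γ) n             ∎
... | no n≢y = begin
  lookup ((x , U) ∷ Γ) (swapN x y n) ≡⟨ cong (lookup ((x , U) ∷ Γ)) (swap-other x y n (≢-sym x≢n) n≢y) ⟩
  lookup ((x , U) ∷ Γ) n             ≡⟨ lookup-there Γ U x≢n ⟩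
  lookup Γ n                         ≡⟨ sym (lookup-there Γ U (≢-sym n≢y)) ⟩
  lookup ((y , U) ∷ Γ) n             ∎
  where
  x≢n : x ≢ n
  x≢n = fresh-≢ x∉Q n∈Q

⊢-α : ∀ {Γ P Q} → P =α Q → (Γ ⊢ P) ⇔ (Γ ⊢ Q)
⊢-α α-𝟎         = ⇔-refl
⊢-α α-inp       = ⇔-refl
⊢-α α-out       = ⇔-refl
⊢-α (α-par p q) = ⊢par-cong (⊢-α p) (⊢-α q)
⊢-α (α-ν p)     = ⊢ν-cong (⊢-α p)
⊢-α {Γ} (α-νdif {x} {y} {U} {P} {Q} _ x∉Q p) = ⊢ν-cong
  (subst (λ R → (((x , U) ∷ Γ) ⊢ P) ⇔ (((x , U) ∷ Γ) ⊢ R)) (swapT≡substT x y Q) (⊢-α p)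
   ⟨⇔⟩ ⇔-sym (⊢-rename (swapN x y) Q
                (injective⇒binderInjective (swap-injective x y) Q)
                (swap-TypeRenaming {Γ} x∉Q)))

⊢-≡s : ∀ {Γ P Q} → P ≡s Q → (Γ ⊢ P) ⇔ (Γ ⊢ Q)
⊢-≡s (≡-α p)       = ⊢-α p
⊢-≡s ≡-refl        = ⇔-refl
⊢-≡s (≡-sym p)     = ⇔-sym (⊢-≡s p)
⊢-≡s (≡-trans p q) = ⊢-≡s p ⟨⇔⟩ ⊢-≡s q
⊢-≡s (≡-parˡ p)    = ⊢par-cong (⊢-≡s p) ⇔-refl
⊢-≡s (≡-parʳ p)    = ⊢par-cong ⇔-refl (⊢-≡s p)
⊢-≡s (≡-ν p)       = ⊢ν-cong (⊢-≡s p)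
⊢-≡s ≡-unit        = mk⇔ (λ { (⊢par _ d) → d }) (⊢par ⊢𝟎)
⊢-≡s ≡-comm        = mk⇔ (λ { (⊢par d e) → ⊢par e d }) (λ { (⊢par d e) → ⊢par e d })
⊢-≡s ≡-assoc       = mk⇔ (λ { (⊢par (⊢par d e) f) → ⊢par d (⊢par e f) })
                         (λ { (⊢par d (⊢par e f)) → ⊢par (⊢par d e) f })
⊢-≡s {Γ} (≡-νswap {P = P} x≢y) =
  ⊢ν-cong (⊢ν-cong (⊢-env-agree P (λ n _ → lookup-exchange {Γ} x≢y n)))
⊢-≡s ≡-ν𝟎          = mk⇔ (λ _ → ⊢𝟎) (λ _ → ⊢ν ⊢𝟎)
⊢-≡s {Γ} (≡-extr {Q = Q} x∉Q) =
  mk⇔ (λ { (⊢par (⊢ν d) e) → ⊢ν (⊢par d (to (⊢-fresh {Γ} Q x∉Q) e)) })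
      (λ { (⊢ν (⊢par d e)) → ⊢par (⊢ν d) (from (⊢-fresh {Γ} Q x∉Q) e) })

mgu-absorbs : ∀ {σ ρ x₁ x₂ x₃ y₁ y₂ y₃} → MGU σ x₁ x₂ x₃ y₁ y₂ y₃ →
  Unifier ρ x₁ x₂ x₃ y₁ y₂ y₃ → ∀ n → ρ (σ n) ≡ ρ n
mgu-absorbs {σ} {ρ} (_ , general , idempotent) ρ-unifies n
  with general ρ ρ-unifies
... | θ , ρ≡θ∘σ = begin
  ρ (σ n)     ≡⟨ ρ≡θ∘σ (σ n) ⟩
  θ (σ (σ n)) ≡⟨ cong θ (idempotent n) ⟩
  θ (σ n)     ≡⟨ sym (ρ≡θ∘σ n) ⟩
  ρ n         ∎

-- Types are coded as names, so that a type assignment becomes a candidate unifier.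
encode : Maybe Ty → Name
encode nothing  = 0
encode (just V) = 1
encode (just W) = 2

decode : Name → Maybe Ty
decode 0 = nothing
decode 1 = just V
decode _ = just W

decode-encode : ∀ t → decode (encode t) ≡ t
decode-encode nothing  = refl
decode-encode (just V) = refl
decode-encode (just W) = refl

mgu-preserves-types : ∀ {Δ u x₁ x₂ x₃ y₁ y₂ y₃ σ} → MGU σ x₁ x₂ x₃ y₁ y₂ y₃ →
  SoloTyped Δ u x₁ x₂ x₃ → SoloTyped Δ u y₁ y₂ y₃ → ∀ w → lookup Δ (σ w) ≡ lookup Δ w
mgu-preserves-types {Δ} {u} {x₁} {x₂} {x₃} {y₁} {y₂} {y₃} {σ} mgu sender receiver w = begin
  lookup Δ (σ w)         ≡⟨ sym (decode-encode (lookup Δ (σ w))) ⟩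
  decode (typeCode (σ w)) ≡⟨ cong decode (mgu-absorbs mgu typeCode-unifies w) ⟩
  decode (typeCode w)     ≡⟨ decode-encode (lookup Δ w) ⟩
  lookup Δ w             ∎
  where
  typeCode : Name → Name
  typeCode n = encode (lookup Δ n)

  typeCode-unifies : Unifier typeCode x₁ x₂ x₃ y₁ y₂ y₃
  typeCode-unifies with objects-determined sender receiver
  ... | e₁ , e₂ , e₃ = cong encode e₁ , cong encode e₂ , cong encode e₃

captureAvoiding⇒binderInjective : ∀ {σ} P → CaptureAvoiding σ P → BinderInjective σ P
captureAvoiding⇒binderInjective {σ} P ca b b∈P n n≢b σn≡σb with σ b ≟ b | σ n ≟ n
... | no σb≢b  | _        = proj₁ (ca b b∈P b σb≢b) refl
... | yes σb≡b | yes σn≡n = n≢b (trans (sym σn≡n) (trans σn≡σb σb≡b))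
... | yes σb≡b | no σn≢n  = proj₂ (ca b b∈P n σn≢n) (sym (trans σn≡σb σb≡b))

-- an idempotent σ fixes its image, so no name in its image is among those it moves
image-unmoved : ∀ {σ zs} → MovesExactly σ zs → (∀ n → σ (σ n) ≡ σ n) → ∀ n → σ n ∉ zs
image-unmoved moves idempotent n σn∈zs = proj₂ (moves _) σn∈zs (idempotent n)

-- Γ extended by the bindings of a restriction prefix, outermost first
bindAll : List (Name × Ty) → Env → Env
bindAll []             Γ = Γ
bindAll ((z , U) ∷ zs) Γ = bindAll zs ((z , U) ∷ Γ)

⊢νs-inv : ∀ zs {Γ R} → Γ ⊢ νs zs R → bindAll zs Γ ⊢ R
⊢νs-inv []             d      = d
⊢νs-inv ((z , U) ∷ zs) (⊢ν d) = ⊢νs-inv zs d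

lookup-bindAll-∉ : ∀ zs {Γ n} → n ∉ map proj₁ zs → lookup (bindAll zs Γ) n ≡ lookup Γ n
lookup-bindAll-∉ []             _    = refl
lookup-bindAll-∉ ((z , U) ∷ zs) {Γ} {n} n∉zs = begin
  lookup (bindAll zs ((z , U) ∷ Γ)) n ≡⟨ lookup-bindAll-∉ zs (λ m → n∉zs (there m)) ⟩
  lookup ((z , U) ∷ Γ) n              ≡⟨ lookup-there Γ U (λ z≡n → n∉zs (here (sym z≡n))) ⟩
  lookup Γ n                          ∎

⊢-reduce : ∀ {Γ P Q} → P ⟶ Q → Γ ⊢ P → Γ ⊢ Q
⊢-reduce {Γ} (red-comm {zs} {u} {P = P} {σ} mgu moves ca) d with ⊢νs-inv zs d
... | ⊢par d-out (⊢par d-inp d-P) =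
  to (⊢-rename σ P (captureAvoiding⇒binderInjective P ca) σ-retypes) d-P
  where
  σ-retypes : TypeRenaming σ (bindAll zs Γ) Γ P
  σ-retypes n _ = begin
    lookup Γ (σ n)
      ≡⟨ sym (lookup-bindAll-∉ zs (image-unmoved moves (proj₂ (proj₂ mgu)) n)) ⟩
    lookup (bindAll zs Γ) (σ n)
      ≡⟨ mgu-preserves-types {bindAll zs Γ} {u} mgu (to ⊢out⇔ d-out) (to ⊢inp⇔ d-inp) n ⟩
    lookup (bindAll zs Γ) n ∎
⊢-reduce (red-par r) (⊢par d e) = ⊢par (⊢-reduce r d) e
⊢-reduce (red-ν r)   (⊢ν d)     = ⊢ν (⊢-reduce r d)
⊢-reduce (red-≡ p r q) d        = to (⊢-≡s q) (⊢-reduce r (to (⊢-≡s p) d))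

proposition5p4 : (Γ : Env) (P Q : Term) →
    (P ≡s Q → (Γ ⊢ P → Γ ⊢ Q) × (Γ ⊢ Q → Γ ⊢ P)) ×
    (P ⟶ Q → Γ ⊢ P → Γ ⊢ Q)
proposition5p4 Γ P Q = (λ P≡Q → to (⊢-≡s P≡Q) , from (⊢-≡s P≡Q)) , ⊢-reduce
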